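{- Let $E$ be a finite set, $\alpha\subseteq E$, $N\geq2$, and let $\mathbb{G},\hat{\mathbb{G}}$ be $\mathsf{E}$-groups. Suppose $h\colon\hat{\mathbb{G}}[\alpha]\to\mathbb{G}[\alpha]$ is a homomorphism of $\alpha$-groups whose restriction to $\hat{\mathbb{G}}[\alpha']$ is injective for every $\alpha'\subsetneq\alpha$. If $\mathbb{G}[\alpha]$ is $N$-acyclic, then $\hat{\mathbb{G}}[\alpha]$ is $N$-acyclic.
   Context: An $\mathsf{E}$-group is a group containing $E$ as a set of pairwise distinct non-trivial involutions that generate it; for $\alpha\subseteq E$, $\mathbb{G}[\alpha]$ is the subgroup generated by $\alpha$, regarded as an $\alpha$-group (a group generated by the distinguished involutions $\alpha$). A homomorphism of $\alpha$-groups is a group homomorphism mapping each $e\in\alpha$ to $e$. For an $\alpha$-group $\mathbb{K}$, a coset cycle of length $n\ge2$ is $(g_i\mathbb{K}[\alpha_i],g_i)_{i\in\mathbb{Z}_n}$ with $g_i\in\mathbb{K}$, $\alpha_i\subseteq\alpha$, such that for all $i$: $g_{i+1}\in g_i\mathbb{K}[\alpha_i]$ and $g_i\mathbb{K}[\alpha_i\cap\alpha_{i-1}]\cap g_{i+1}\mathbb{K}[\alpha_i\cap\alpha_{i+1}]=\emptyset$; $\mathbb{K}$ is $N$-acyclic if it has no coset cycle of length $n$ with $2\le n\le N$. -}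

module Defs where

open import Level using (Level; _⊔_)
open import Data.Nat using (ℕ; zero; suc; _≤_)
open import Data.Nat.DivMod using (_%_; m%n<n)
open import Data.Fin using (Fin; toℕ; fromℕ<)
open import Data.Fin.Subset using (Subset; _∈_; _⊆_; _∩_; _⊂_; ⊤)
open import Data.List using (List; []; _∷_)
open import Data.List.Relation.Unary.All using (All)
open import Data.Product using (Σ; _×_; ∃)
open import Relation.Nullary using (¬_)
open import Relation.Binary.PropositionalEquality using (_≡_)
open import Algebra.Bundles using (Group)

nextᶜ : ∀ {n} → Fin n → Fin n
nextᶜ {suc k} i = fromℕ< (m%n<n (suc (toℕ i)) (suc k))

prevᶜ : ∀ {n} → Fin n → Fin n
prevᶜ {suc k} i = fromℕ< (m%n<n (toℕ i Data.Nat.+ k) (suc k))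

-- A group G together with a labelling ι : Fin m → G of the distinguished
-- elements E = Fin m (E a finite set).
module EG {c ℓ : Level} (G : Group c ℓ) {m : ℕ} (ι : Fin m → Group.Carrier G) where
  open Group G

  eval : List (Fin m) → Carrier
  eval []      = ε
  eval (e ∷ w) = ι e ∙ eval w

  -- x lies in the subgroup G[β] generated by β (words suffice: generators are involutions)
  _∈⟨_⟩ : Carrier → Subset m → Set ℓ
  x ∈⟨ β ⟩ = Σ (List (Fin m)) λ w → All (_∈ β) w × (eval w ≈ x)

  record IsEGroup : Set (c ⊔ ℓ) where
    field
      distinct    : ∀ e e′ → ι e ≈ ι e′ → e ≡ e′
      nontrivial  : ∀ e → ¬ (ι e ≈ ε)
      involution  : ∀ e → ι e ∙ ι e ≈ ε
      generates   : ∀ x → x ∈⟨ ⊤ ⟩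

  -- A coset cycle of length n in the α-group K = G[α].
  -- g ∈ g_i K[β] is expressed as g_i⁻¹ ∙ g ∈ K[β] = G[β] (β ⊆ α).
  record CosetCycle (α : Subset m) (n : ℕ) : Set (c ⊔ ℓ) where
    field
      g      : Fin n → Carrier
      αs     : Fin n → Subset m
      g∈K    : ∀ i → g i ∈⟨ α ⟩
      αs⊆α   : ∀ i → αs i ⊆ α
      step   : ∀ i → (g i ⁻¹ ∙ g (nextᶜ i)) ∈⟨ αs i ⟩
      disj   : ∀ i (x : Carrier) →
                 ¬ (((g i ⁻¹ ∙ x) ∈⟨ αs i ∩ αs (prevᶜ i) ⟩)
                   × ((g (nextᶜ i) ⁻¹ ∙ x) ∈⟨ αs i ∩ αs (nextᶜ i) ⟩))

  Acyclic : Subset m → ℕ → Set (c ⊔ ℓ)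
  Acyclic α N = ∀ n → 2 ≤ n → n ≤ N → ¬ CosetCycle α n

record AlphaHom {c ℓ c′ ℓ′ : Level} (Ĝ : Group c′ ℓ′) (G : Group c ℓ) {m : ℕ}
                (ι̂ : Fin m → Group.Carrier Ĝ) (ι : Fin m → Group.Carrier G)
                (α : Subset m) : Set (c ⊔ ℓ ⊔ c′ ⊔ ℓ′) where
  private
    module Ĝ = Group Ĝ
    module G = Group G
    module Ê = EG Ĝ ι̂
    module E = EG G ι
  field
    h        : (x : Ĝ.Carrier) → x Ê.∈⟨ α ⟩ → G.Carrier
    into     : ∀ x p → h x p E.∈⟨ α ⟩
    cong     : ∀ x y p q → x Ĝ.≈ y → h x p G.≈ h y q
    hom      : ∀ x y p q r → h (x Ĝ.∙ y) r G.≈ (h x p G.∙ h y q)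
    preserve : ∀ e (p : e ∈ α) q → h (ι̂ e) q G.≈ ι e

  InjectiveOn : Subset m → Set (c′ ⊔ ℓ′ ⊔ ℓ)
  InjectiveOn α′ = ∀ x y p q → x Ê.∈⟨ α′ ⟩ → y Ê.∈⟨ α′ ⟩ → h x p G.≈ h y q → x Ĝ.≈ y

-- Push a coset cycle of Ĝ[α] forward along h. Since h maps Ĝ[β] into G[β] for
-- every β ⊆ α, the images again form a chain of cosets with the same sets αᵢ.
-- No αᵢ of a coset cycle is contained in αᵢ₊₁ (else gᵢ would lie in both cosets
-- at i), so every αᵢ is a proper subset of α, where h is injective; this lets an
-- element witnessing that two consecutive image cosets meet be lifted to such a
-- witness in Ĝ. Hence a short cycle in Ĝ[α] gives one in G[α].
module Submission where

open import Defs
open import Level using (Level)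
open import Data.Nat using (ℕ; _≤_; suc; s≤s; _%_)
open import Data.Nat.DivMod using (n%n≡0; m<n⇒m%n≡m)
open import Data.Fin as Fin using (Fin; toℕ; fromℕ; inject₁)
open import Data.Fin.Properties using (toℕ-injective; toℕ-fromℕ<; toℕ-fromℕ; toℕ-inject₁; toℕ<n)
open import Data.Fin.Subset using (Subset; _∈_; _⊆_; _⊈_; _⊂_; _∩_)
open import Data.Fin.Subset.Properties using (_∈?_; _⊂?_; ⊆-trans; p∩q⊆p; x∈p∩q⁺)
open import Data.List using (List; []; _∷_; _++_; reverse)
open import Data.List.Properties using (unfold-reverse)
open import Data.List.Relation.Unary.All as All using (All; []; _∷_)
open import Data.List.Relation.Unary.All.Properties using (++⁺)
open import Data.List.Relation.Unary.Any.Properties using (reverse⁻)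
open import Data.Product using (∃; _×_; _,_)
open import Relation.Nullary using (¬_)
open import Relation.Nullary.Decidable using (decidable-stable)
open import Relation.Binary.PropositionalEquality as ≡ using (_≡_; module ≡-Reasoning)
open import Algebra.Bundles using (Group)
import Algebra.Properties.Group as GroupProperties
import Relation.Binary.Reasoning.Setoid as SetoidReasoning

nextᶜ-surjective : ∀ {n} (j : Fin n) → ∃ λ i → nextᶜ i ≡ j
nextᶜ-surjective {suc k} Fin.zero = fromℕ k , toℕ-injective (begin
  toℕ (nextᶜ (fromℕ k))        ≡⟨ toℕ-fromℕ< _ ⟩
  suc (toℕ (fromℕ k)) % suc k  ≡⟨ ≡.cong (λ t → suc t % suc k) (toℕ-fromℕ k) ⟩
  suc k % suc k                ≡⟨ n%n≡0 (suc k) ⟩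
  0                            ∎)
  where open ≡-Reasoning
nextᶜ-surjective {suc k} (Fin.suc j) = inject₁ j , toℕ-injective (begin
  toℕ (nextᶜ (inject₁ j))        ≡⟨ toℕ-fromℕ< _ ⟩
  suc (toℕ (inject₁ j)) % suc k  ≡⟨ ≡.cong (λ t → suc t % suc k) (toℕ-inject₁ j) ⟩
  suc (toℕ j) % suc k            ≡⟨ m<n⇒m%n≡m (s≤s (toℕ<n j)) ⟩
  suc (toℕ j)                    ∎)
  where open ≡-Reasoning

p⊆q∧q⊈p⇒p⊂q : ∀ {n} {p q : Subset n} → p ⊆ q → q ⊈ p → p ⊂ q
p⊆q∧q⊈p⇒p⊂q {p = p} {q} p⊆q q⊈p = decidable-stable (p ⊂? q) λ p⊄q →
  q⊈p λ {x} x∈q → decidable-stable (x ∈? p) λ x∉p → p⊄q (p⊆q , x , x∈q , x∉p)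

All-reverse⁺ : ∀ {a p} {A : Set a} {P : A → Set p} {xs : List A} → All P xs → All P (reverse xs)
All-reverse⁺ all = All.tabulate λ x∈ → All.lookup all (reverse⁻ x∈)

module Subgroup {c ℓ : Level} (G : Group c ℓ) {m : ℕ} (ι : Fin m → Group.Carrier G) where
  open Group G
  open GroupProperties G using (inverseˡ-unique; ε⁻¹≈ε; ⁻¹-anti-homo-∙; ⁻¹-anti-homo-\\)
  open EG G ι
  open SetoidReasoning setoid

  eval-++ : ∀ w v → eval (w ++ v) ≈ eval w ∙ eval v
  eval-++ []      v = sym (identityˡ (eval v))
  eval-++ (e ∷ w) v = trans (∙-congˡ (eval-++ w v)) (sym (assoc (ι e) (eval w) (eval v)))

  eval-∈⟨⟩ : ∀ {β w} → All (_∈ β) w → eval w ∈⟨ β ⟩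
  eval-∈⟨⟩ {w = w} w⊆β = w , w⊆β , refl

  ∈⟨⟩-resp-≈ : ∀ {β x y} → x ≈ y → x ∈⟨ β ⟩ → y ∈⟨ β ⟩
  ∈⟨⟩-resp-≈ x≈y (w , w⊆β , w≈x) = w , w⊆β , trans w≈x x≈y

  ∈⟨⟩-mono : ∀ {β γ x} → β ⊆ γ → x ∈⟨ β ⟩ → x ∈⟨ γ ⟩
  ∈⟨⟩-mono β⊆γ (w , w⊆β , w≈x) = w , All.map β⊆γ w⊆β , w≈x

  ε-∈⟨⟩ : ∀ {β} → ε ∈⟨ β ⟩
  ε-∈⟨⟩ = eval-∈⟨⟩ []

  ι-∈⟨⟩ : ∀ {β e} → e ∈ β → ι e ∈⟨ β ⟩
  ι-∈⟨⟩ e∈β = ∈⟨⟩-resp-≈ (identityʳ _) (eval-∈⟨⟩ (e∈β ∷ []))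

  ∙-∈⟨⟩ : ∀ {β x y} → x ∈⟨ β ⟩ → y ∈⟨ β ⟩ → (x ∙ y) ∈⟨ β ⟩
  ∙-∈⟨⟩ (w , w⊆β , w≈x) (v , v⊆β , v≈y) =
    w ++ v , ++⁺ w⊆β v⊆β , trans (eval-++ w v) (∙-cong w≈x v≈y)

  module _ (involution : ∀ e → ι e ∙ ι e ≈ ε) where

    eval-reverse : ∀ w → eval (reverse w) ≈ eval w ⁻¹
    eval-reverse []      = sym ε⁻¹≈ε
    eval-reverse (e ∷ w) = begin
      eval (reverse (e ∷ w))          ≡⟨ ≡.cong eval (unfold-reverse e w) ⟩
      eval (reverse w ++ e ∷ [])      ≈⟨ eval-++ (reverse w) (e ∷ []) ⟩
      eval (reverse w) ∙ (ι e ∙ ε)    ≈⟨ ∙-cong (eval-reverse w) (identityʳ (ι e)) ⟩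
      eval w ⁻¹ ∙ ι e                 ≈⟨ ∙-congˡ (inverseˡ-unique (ι e) (ι e) (involution e)) ⟩
      eval w ⁻¹ ∙ ι e ⁻¹              ≈⟨ ⁻¹-anti-homo-∙ (ι e) (eval w) ⟨
      (ι e ∙ eval w) ⁻¹               ∎

    ⁻¹-∈⟨⟩ : ∀ {β x} → x ∈⟨ β ⟩ → (x ⁻¹) ∈⟨ β ⟩
    ⁻¹-∈⟨⟩ (w , w⊆β , w≈x) = reverse w , All-reverse⁺ w⊆β , trans (eval-reverse w) (⁻¹-cong w≈x)

    \\-swap-∈⟨⟩ : ∀ {β x y} → (x \\ y) ∈⟨ β ⟩ → (y \\ x) ∈⟨ β ⟩
    \\-swap-∈⟨⟩ x\\y∈β = ∈⟨⟩-resp-≈ (⁻¹-anti-homo-\\ _ _) (⁻¹-∈⟨⟩ x\\y∈β)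

module CosetCycleProperties {c ℓ : Level} (G : Group c ℓ) {m : ℕ} (ι : Fin m → Group.Carrier G)
    (involution : ∀ e → Group._≈_ G (Group._∙_ G (ι e) (ι e)) (Group.ε G))
    {α : Subset m} {n : ℕ} (C : EG.CosetCycle G ι α n) where
  open Group G
  open EG G ι
  open CosetCycle C
  open Subgroup G ι

  αs⊈αs-next : ∀ i → αs i ⊈ αs (nextᶜ i)
  αs⊈αs-next i αsᵢ⊆αsᵢ₊₁ = disj i (g i) (g-left , g-right)
    where
      g-left : (g i \\ g i) ∈⟨ αs i ∩ αs (prevᶜ i) ⟩
      g-left = ∈⟨⟩-resp-≈ (sym (inverseˡ (g i))) ε-∈⟨⟩
      g-right : (g (nextᶜ i) \\ g i) ∈⟨ αs i ∩ αs (nextᶜ i) ⟩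
      g-right = ∈⟨⟩-mono (λ z → x∈p∩q⁺ (z , αsᵢ⊆αsᵢ₊₁ z)) (\\-swap-∈⟨⟩ involution (step i))

  α⊈αs : ∀ i → α ⊈ αs i
  α⊈αs i with nextᶜ-surjective i
  ... | j , ≡.refl = λ α⊆αsᵢ → αs⊈αs-next j (⊆-trans (αs⊆α j) α⊆αsᵢ)

  αs⊂α : ∀ i → αs i ⊂ α
  αs⊂α i = p⊆q∧q⊈p⇒p⊂q (αs⊆α i) (α⊈αs i)

module AlphaHomProperties {c ℓ c′ ℓ′ : Level} {Ĝ : Group c′ ℓ′} {G : Group c ℓ} {m : ℕ}
    {ι̂ : Fin m → Group.Carrier Ĝ} {ι : Fin m → Group.Carrier G} {α : Subset m}
    (φ : AlphaHom Ĝ G ι̂ ι α) where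
  private
    module Ĝ = Group Ĝ
    module Ê = EG Ĝ ι̂
    module Ŝ = Subgroup Ĝ ι̂
  open Group G
  open GroupProperties G using (identityˡ-unique; inverseˡ-unique)
  open EG G ι
  open AlphaHom φ renaming (cong to h-cong)
  open SetoidReasoning setoid

  h-ε : ∀ p → h Ĝ.ε p ≈ ε
  h-ε p = identityˡ-unique _ _ (begin
    h Ĝ.ε p ∙ h Ĝ.ε p     ≈⟨ hom _ _ p p ε∙ε∈α ⟨
    h (Ĝ.ε Ĝ.∙ Ĝ.ε) ε∙ε∈α  ≈⟨ h-cong _ _ ε∙ε∈α p (Ĝ.identityˡ Ĝ.ε) ⟩
    h Ĝ.ε p               ∎)
    where ε∙ε∈α = Ŝ.∙-∈⟨⟩ p p

  h-⁻¹ : ∀ x p q → h (x Ĝ.⁻¹) p ≈ h x q ⁻¹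
  h-⁻¹ x p q = inverseˡ-unique _ _ (begin
    h (x Ĝ.⁻¹) p ∙ h x q     ≈⟨ hom _ _ p q x⁻¹∙x∈α ⟨
    h (x Ĝ.⁻¹ Ĝ.∙ x) x⁻¹∙x∈α  ≈⟨ h-cong _ _ x⁻¹∙x∈α Ŝ.ε-∈⟨⟩ (Ĝ.inverseˡ x) ⟩
    h Ĝ.ε Ŝ.ε-∈⟨⟩            ≈⟨ h-ε _ ⟩
    ε                        ∎)
    where x⁻¹∙x∈α = Ŝ.∙-∈⟨⟩ p q

  h-\\ : ∀ {x y} p⁻¹ p q r → h (x Ĝ.\\ y) r ≈ h x p \\ h y q
  h-\\ {x} p⁻¹ p q r = trans (hom _ _ p⁻¹ q r) (∙-congʳ (h-⁻¹ x p⁻¹ p))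

  h-eval : ∀ {w} → All (_∈ α) w → ∀ p → h (Ê.eval w) p ≈ eval w
  h-eval []                  p = h-ε p
  h-eval {e ∷ w} (e∈α ∷ w⊆α) p = begin
    h (ι̂ e Ĝ.∙ Ê.eval w) p           ≈⟨ hom _ _ ι̂e∈α w∈α p ⟩
    h (ι̂ e) ι̂e∈α ∙ h (Ê.eval w) w∈α  ≈⟨ ∙-cong (preserve e e∈α ι̂e∈α) (h-eval w⊆α w∈α) ⟩
    ι e ∙ eval w                     ∎
    where
      ι̂e∈α = Ŝ.ι-∈⟨⟩ e∈α
      w∈α = Ŝ.eval-∈⟨⟩ w⊆α

  h-∈⟨⟩ : ∀ {β x} → β ⊆ α → x Ê.∈⟨ β ⟩ → ∀ p → h x p ∈⟨ β ⟩
  h-∈⟨⟩ β⊆α (w , w⊆β , w≈x) p =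
    w , w⊆β , sym (trans (h-cong _ _ p w∈α (Ĝ.sym w≈x)) (h-eval (All.map β⊆α w⊆β) w∈α))
    where w∈α = Ŝ.eval-∈⟨⟩ (All.map β⊆α w⊆β)

module ImageCycle {c ℓ c′ ℓ′ : Level} {Ĝ : Group c′ ℓ′} {G : Group c ℓ} {m : ℕ}
    {ι̂ : Fin m → Group.Carrier Ĝ} {ι : Fin m → Group.Carrier G} {α : Subset m}
    (involution : ∀ e → Group._≈_ Ĝ (Group._∙_ Ĝ (ι̂ e) (ι̂ e)) (Group.ε Ĝ))
    (φ : AlphaHom Ĝ G ι̂ ι α)
    (injective : ∀ α′ → α′ ⊂ α → AlphaHom.InjectiveOn φ α′)
    {n : ℕ} (C : EG.CosetCycle Ĝ ι̂ α n) where
  private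
    module Ĝ = Group Ĝ
    module Ê = EG Ĝ ι̂
    module Ŝ = Subgroup Ĝ ι̂
  open Group G
  open GroupProperties G using (\\-leftDividesˡ)
  open EG G ι
  open Subgroup G ι using (∈⟨⟩-resp-≈)
  open AlphaHom φ using (h; hom; into)
  open AlphaHomProperties φ
  open Ê.CosetCycle C
  open CosetCycleProperties Ĝ ι̂ involution C using (αs⊂α)
  open SetoidReasoning setoid

  hg : Fin n → Carrier
  hg i = h (g i) (g∈K i)

  image-step : ∀ i → (hg i \\ hg (nextᶜ i)) ∈⟨ αs i ⟩
  image-step i = ∈⟨⟩-resp-≈
    (h-\\ (Ŝ.⁻¹-∈⟨⟩ involution (g∈K i)) (g∈K i) (g∈K (nextᶜ i)) _)
    (h-∈⟨⟩ (αs⊆α i) (step i) (Ŝ.∈⟨⟩-mono (αs⊆α i) (step i)))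

  -- x̂ lifts x on the left coset; injectivity on Ĝ[αᵢ] transfers the right one.
  image-disj : ∀ i x → ¬ ((hg i \\ x) ∈⟨ αs i ∩ αs (prevᶜ i) ⟩
                          × (hg (nextᶜ i) \\ x) ∈⟨ αs i ∩ αs (nextᶜ i) ⟩)
  image-disj i x ((w , w⊆ , w≈) , (v , v⊆ , v≈)) = disj i x̂ (x̂-left , x̂-right)
    where
      j = nextᶜ i
      W = Ê.eval w
      V = Ê.eval v
      x̂ = g i Ĝ.∙ W
      w⊆α = All.map (λ z → αs⊆α i (p∩q⊆p _ _ z)) w⊆
      v⊆α = All.map (λ z → αs⊆α i (p∩q⊆p _ _ z)) v⊆
      W∈α = Ŝ.eval-∈⟨⟩ w⊆α
      V∈α = Ŝ.eval-∈⟨⟩ v⊆α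
      V∈ : V Ê.∈⟨ αs i ⟩
      V∈ = Ŝ.eval-∈⟨⟩ (All.map (p∩q⊆p _ _) v⊆)
      X∈ : (g j Ĝ.\\ x̂) Ê.∈⟨ αs i ⟩
      X∈ = Ŝ.∈⟨⟩-resp-≈ (Ĝ.assoc _ _ _)
             (Ŝ.∙-∈⟨⟩ (Ŝ.\\-swap-∈⟨⟩ involution (step i)) (Ŝ.eval-∈⟨⟩ (All.map (p∩q⊆p _ _) w⊆)))
      X∈α = Ŝ.∈⟨⟩-mono (αs⊆α i) X∈
      x̂∈α = Ŝ.∙-∈⟨⟩ (g∈K i) W∈α
      hX≈hV : h (g j Ĝ.\\ x̂) X∈α ≈ h V V∈α
      hX≈hV = begin
        h (g j Ĝ.\\ x̂) X∈α          ≈⟨ h-\\ (Ŝ.⁻¹-∈⟨⟩ involution (g∈K j)) (g∈K j) x̂∈α X∈α ⟩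
        hg j \\ h x̂ x̂∈α             ≈⟨ ∙-congˡ (hom _ _ (g∈K i) W∈α x̂∈α) ⟩
        hg j \\ (hg i ∙ h W W∈α)     ≈⟨ ∙-congˡ (∙-congˡ (trans (h-eval w⊆α W∈α) w≈)) ⟩
        hg j \\ (hg i ∙ (hg i \\ x)) ≈⟨ ∙-congˡ (\\-leftDividesˡ (hg i) x) ⟩
        hg j \\ x                    ≈⟨ trans (h-eval v⊆α V∈α) v≈ ⟨
        h V V∈α                      ∎
      x̂-left : (g i Ĝ.\\ x̂) Ê.∈⟨ αs i ∩ αs (prevᶜ i) ⟩
      x̂-left = Ŝ.∈⟨⟩-resp-≈ (Ĝ.sym (GroupProperties.\\-leftDividesʳ Ĝ (g i) W)) (Ŝ.eval-∈⟨⟩ w⊆)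
      x̂-right : (g j Ĝ.\\ x̂) Ê.∈⟨ αs i ∩ αs j ⟩
      x̂-right = Ŝ.∈⟨⟩-resp-≈
        (Ĝ.sym (injective (αs i) (αs⊂α i) _ _ X∈α V∈α X∈ V∈ hX≈hV)) (Ŝ.eval-∈⟨⟩ v⊆)

  imageCycle : CosetCycle α n
  imageCycle = record
    { g = hg ; αs = αs ; g∈K = λ i → into _ _ ; αs⊆α = αs⊆α
    ; step = image-step ; disj = image-disj }

lemma3p6 : ∀ {c ℓ c′ ℓ′ : Level} {m : ℕ} (α : Subset m) (N : ℕ) → 2 ≤ N →
    (G : Group c ℓ) (ι : Fin m → Group.Carrier G) →
    (Ĝ : Group c′ ℓ′) (ι̂ : Fin m → Group.Carrier Ĝ) →
    EG.IsEGroup G ι → EG.IsEGroup Ĝ ι̂ →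
    (φ : AlphaHom Ĝ G ι̂ ι α) →
    (∀ α′ → α′ ⊂ α → AlphaHom.InjectiveOn φ α′) →
    EG.Acyclic G ι α N → EG.Acyclic Ĝ ι̂ α N
lemma3p6 α N _ G ι Ĝ ι̂ _ Ĝ-isEGroup φ injective G-acyclic n 2≤n n≤N C =
  G-acyclic n 2≤n n≤N (ImageCycle.imageCycle (EG.IsEGroup.involution Ĝ-isEGroup) φ injective C)
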